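{- Let $\mathbb{F}$ be a finite field of odd order $q$. Let $\alpha\in\mathbb{F}$ be such that $\alpha$ is a square in $\mathbb{F}$ but $\alpha+1$ is not, and let $\lambda\in\mathbb{F}$ satisfy $\lambda^2=2^2\cdot\alpha$. Let $$\mathcal{F}=\left\{\begin{pmatrix} v & w\\ w & \lambda w+v\end{pmatrix}\in M^{2\times 2}(\mathbb{F}) : v\in\mathbb{F},\ w\in\mathbb{F}\setminus\{0\}\right\}.$$ Then $|\mathcal{F}|=q(q-1)$, for each $C\in\mathcal{F}$ the subspace $\left[\begin{array}{c} I\\ C\end{array}\right]$ generates a linear sudoku square of parallel type of order $q^2$, and the $q(q-1)$ sudoku squares so obtained are mutually orthogonal.
   Context: For $A,B\in M^{2\times 2}(\mathbb{F})$, $\left[\begin{array}{c} A\\ B\end{array}\right]$ denotes the subspace of $\mathbb{F}^4$ spanned by the columns of the $4\times 2$ matrix $\begin{pmatrix} A\\ B\end{pmatrix}$; $I$ is the $2\times 2$ identity matrix. A sudoku square of order $n^2$ is a latin square of order $n^2$ such that, when the array is partitioned into $n\times n$ subsquares in the natural way, each subsquare contains every symbol. Locations of an array of order $q^2$ are identified with vectors $(x_1,x_2,x_3,x_4)\in\mathbb{F}^4$: $x_1$ is the large row (which horizontal band of $q$ subsquares), $x_2$ the mini row (row within the band), $x_3$ the large column, $x_4$ the mini column; so the row of a location is determined by $(x_1,x_2)$, its column by $(x_3,x_4)$, and its subsquare by $(x_1,x_3)$. For a two-dimensional subspace $g\subseteq\mathbb{F}^4$, the array $M_g$ assigns to the locations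 in each coset $x+g$ a common symbol, distinct cosets receiving distinct symbols. We say $g$ generates a linear sudoku square of parallel type if $M_g$ is a sudoku square. Two squares of the same order are orthogonal if, upon superimposition, each ordered pair of symbols occurs in exactly one location. (Such an $\alpha$ exists whenever $q$ is odd.) -}

module Defs where

open import Level using (Level; suc; _⊔_)
open import Data.Nat using (ℕ)
open import Data.Nat.Divisibility using (_∣_)
open import Data.Fin using (Fin)
open import Data.Product using (Σ; ∃; ∃-syntax; _×_; _,_)
open import Data.List using (List; length)
open import Data.List.Membership.Propositional using (_∈_)
open import Data.List.Relation.Unary.Unique.Propositional using (Unique)
open import Relation.Nullary using (¬_)
open import Relation.Binary.PropositionalEquality using (_≡_; _≢_)
open import Algebra.Structures using (IsCommutativeRing)
open import Function.Bundles using (_↔_; _⇔_)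

record FiniteField (c : Level) : Set (suc c) where
  infixl 7 _*_
  infixl 6 _+_
  field
    Carrier : Set c
    _+_ _*_ : Carrier → Carrier → Carrier
    -_      : Carrier → Carrier
    0# 1#   : Carrier
    isCommutativeRing : IsCommutativeRing _≡_ _+_ _*_ -_ 0# 1#
    0≢1     : 0# ≢ 1#
    inverse : ∀ x → x ≢ 0# → ∃[ y ] (x * y ≡ 1#)
    order   : ℕ
    enum    : Fin order ↔ Carrier

module FF {c : Level} (𝔽 : FiniteField c) where
  open FiniteField 𝔽 public

  2# : Carrier
  2# = 1# + 1#

  IsSquare : Carrier → Set c
  IsSquare a = ∃[ b ] (b * b ≡ a)

  -- 2×2 matrices ( a b / c d ) as 4-tuples (a , b , c , d)
  Mat : Set c
  Mat = Carrier × Carrier × Carrier × Carrier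

  -- vectors of 𝔽⁴: (x₁ , x₂ , x₃ , x₄) = (large row, mini row, large column, mini column)
  V4 : Set c
  V4 = Carrier × Carrier × Carrier × Carrier

  _-v_ : V4 → V4 → V4
  (a₁ , a₂ , a₃ , a₄) -v (b₁ , b₂ , b₃ , b₄) =
    (a₁ + - b₁ , a₂ + - b₂ , a₃ + - b₃ , a₄ + - b₄)

  _∈[I/_] : V4 → Mat → Set c
  x ∈[I/ (c₁₁ , c₁₂ , c₂₁ , c₂₂) ] =
    ∃[ a ] ∃[ b ] (x ≡ (a * 1# + b * 0# , a * 0# + b * 1# ,
                        a * c₁₁ + b * c₁₂ , a * c₂₁ + b * c₂₂))

  -- Locations x, y carry the same symbol of M_g (g = [I;C]) iff x + g = y + g.
  SameSymbol : Mat → V4 → V4 → Set c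
  SameSymbol C x y = (x -v y) ∈[I/ C ]

  ∃! : {A : Set c} → (A → Set c) → Set c
  ∃! {A} P = Σ A λ a → P a × (∀ b → P b → b ≡ a)

  -- M_g is a sudoku square: every symbol (coset x + g) occurs exactly once
  -- in every row (x₁,x₂), every column (x₃,x₄) and every subsquare (x₁,x₃).
  GeneratesSudoku : Mat → Set c
  GeneratesSudoku C =
      (∀ x₁ x₂ (s : V4) → ∃! {Carrier × Carrier} λ { (x₃ , x₄) → SameSymbol C (x₁ , x₂ , x₃ , x₄) s })
    × (∀ x₃ x₄ (s : V4) → ∃! {Carrier × Carrier} λ { (x₁ , x₂) → SameSymbol C (x₁ , x₂ , x₃ , x₄) s })
    × (∀ x₁ x₃ (s : V4) → ∃! {Carrier × Carrier} λ { (x₂ , x₄) → SameSymbol C (x₁ , x₂ , x₃ , x₄) s })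

  Orthogonal : Mat → Mat → Set c
  Orthogonal C D = ∀ (s t : V4) → ∃! {V4} λ z → SameSymbol C z s × SameSymbol D z t

  _∈𝓕[_] : Mat → Carrier → Set c
  C ∈𝓕[ λ' ] = ∃[ v ] ∃[ w ] (w ≢ 0# × C ≡ (v , w , w , λ' * w + v))

  HasCard : (Mat → Set c) → ℕ → Set c
  HasCard P n = ∃[ L ] (length L ≡ n × Unique L × (∀ C → (C ∈ L) ⇔ P C))

-- The matrices v I + w J with J = (0 1 / 1 λ) form the commutative algebra 𝔽[J], J² = λ J + I, and
-- det (v I + w J) = v² + λ v w - w² is its norm form. Completing the square,
-- 4 det = (2v + λw)² - (λ² + 4) w², and λ² + 4 = 4 (α + 1) is not a square, so the norm is anisotropic:
-- every nonzero element of 𝔽[J] is invertible, in particular every C ∈ 𝓕 and every difference of two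
-- distinct members of 𝓕, which again lies in 𝔽[J].
-- The cosets of [ I ; C ] are graphs of the affine maps u ↦ C u + const, so M_[I;C] is latin on rows
-- automatically, on columns when C is invertible, and on subsquares when c₁₂ = w ≠ 0; two such squares
-- are orthogonal when C - D is invertible, since then the two affine maps agree at exactly one point.
module Submission where

open import Defs
open import Level using (Level)
import Data.Nat as ℕ
open import Data.Nat.Divisibility using (_∣_)
open import Data.Product using (_×_)
open import Relation.Nullary using (¬_)
open import Relation.Binary.PropositionalEquality using (_≡_; _≢_)

open import Algebra using (CommutativeRing)
import Algebra.Solver.Ring.AlmostCommutativeRing as ACR
open import Data.Empty using (⊥-elim)
open import Data.Fin as Fin using (Fin)
import Data.Fin.Properties as Fin
open import Data.Integer as ℤ using (ℤ; -[1+_]; sign; ∣_∣; _◃_)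
import Data.Integer.Properties as ℤ
open import Data.List using (List; []; _∷_; length; map; _++_; tabulate; cartesianProductWith)
import Data.List.Properties as List
open import Data.List.Membership.Propositional using (_∈_)
import Data.List.Membership.Propositional.Properties as Membership
open import Data.List.Relation.Unary.Unique.Propositional using (Unique)
import Data.List.Relation.Unary.Unique.Propositional.Properties as Unique
open import Data.Maybe using (Maybe; just; nothing)
open import Data.Nat using (ℕ; zero; suc)
import Data.Nat.Properties as ℕ
open import Data.Product using (_,_; proj₁; proj₂)
open import Data.Product.Function.NonDependent.Propositional using (_×-⇔_)
open import Data.Product.Properties using (×-≡,≡→≡; ×-≡,≡←≡)
open import Data.Sign as Sign using (Sign)
open import Function using (_∘_)
open import Function.Bundles using (Equivalence; Inverse; Injection; _↔_; _⇔_; mk⇔; mk↔ₛ′)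
open import Function.Construct.Composition using (_⇔-∘_)
open import Function.Construct.Identity using (⇔-id)
open import Function.Construct.Symmetry using (⇔-sym)
open import Function.Definitions using (Injective)
open import Function.Properties.Inverse using (↔⇒↣; ↔-sym)
open import Relation.Binary.Definitions using (DecidableEquality)
open import Relation.Binary.PropositionalEquality using (refl; sym; trans; cong; cong₂; subst; module ≡-Reasoning)
open import Relation.Nullary using (yes; no)

-- The ring solver with ℤ coefficients, read through the canonical map n ↦ n ×′ 1#. The type-checking-optimised
-- _×′_ makes ⟦ + 2 ⟧ reduce to 1# + 1#, so numerals in solver goals coincide definitionally with 2# and the like.
module IntegerCoefficients {c ℓ} (R : CommutativeRing c ℓ) where
  open CommutativeRing R renaming (refl to ≈-refl; sym to ≈-sym; trans to ≈-trans; reflexive to ≈-reflexive)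
  open import Algebra.Properties.Ring ring using (-0#≈0#; -‿involutive; -‿+-comm; xyx⁻¹≈y; -1*x≈-x)
  open import Algebra.Properties.Semiring.Mult.TCOptimised semiring using (1+×; ×-homo-+; ×1-homo-*)
    renaming (_×_ to _×′_)
  open import Algebra.Properties.CommutativeSemigroup *-commutativeSemigroup using (interchange)
  open import Relation.Binary.Reasoning.Setoid setoid

  ⟦_⟧ : ℤ → Carrier
  ⟦ ℤ.+ n ⟧    = n ×′ 1#
  ⟦ -[1+ n ] ⟧ = - (suc n ×′ 1#)

  ⟦⟧-⊖ : ∀ m n → ⟦ m ℤ.⊖ n ⟧ ≈ m ×′ 1# + - (n ×′ 1#)
  ⟦⟧-⊖ zero    zero    = ≈-sym (≈-trans (+-congˡ -0#≈0#) (+-identityʳ 0#))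
  ⟦⟧-⊖ (suc m) zero    = ≈-sym (≈-trans (+-congˡ -0#≈0#) (+-identityʳ _))
  ⟦⟧-⊖ zero    (suc n) = ≈-sym (+-identityˡ _)
  ⟦⟧-⊖ (suc m) (suc n) = begin
    ⟦ suc m ℤ.⊖ suc n ⟧           ≡⟨ cong ⟦_⟧ (ℤ.[1+m]⊖[1+n]≡m⊖n m n) ⟩
    ⟦ m ℤ.⊖ n ⟧                   ≈⟨ ⟦⟧-⊖ m n ⟩
    M + - N                       ≈⟨ +-congʳ (xyx⁻¹≈y 1# M) ⟨
    1# + M + - 1# + - N           ≈⟨ +-assoc _ _ _ ⟩
    1# + M + (- 1# + - N)         ≈⟨ +-congˡ (-‿+-comm 1# N) ⟩
    1# + M + - (1# + N)           ≈⟨ +-cong (1+× m 1#) (-‿cong (1+× n 1#)) ⟨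
    suc m ×′ 1# + - (suc n ×′ 1#)   ∎
    where
    M N : Carrier
    M = m ×′ 1#
    N = n ×′ 1#

  ⟦⟧-+ : ∀ i j → ⟦ i ℤ.+ j ⟧ ≈ ⟦ i ⟧ + ⟦ j ⟧
  ⟦⟧-+ -[1+ m ]  -[1+ n ]  = begin
    - (suc (suc (m ℕ.+ n)) ×′ 1#)       ≡⟨ cong (λ k → - (suc k ×′ 1#)) (ℕ.+-suc m n) ⟨
    - ((suc m ℕ.+ suc n) ×′ 1#)         ≈⟨ -‿cong (×-homo-+ 1# (suc m) (suc n)) ⟩
    - (suc m ×′ 1# + suc n ×′ 1#)        ≈⟨ -‿+-comm _ _ ⟨
    - (suc m ×′ 1#) + - (suc n ×′ 1#)    ∎
  ⟦⟧-+ -[1+ m ]  (ℤ.+ n)   = ≈-trans (⟦⟧-⊖ n (suc m)) (+-comm _ _)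
  ⟦⟧-+ (ℤ.+ m)   -[1+ n ]  = ⟦⟧-⊖ m (suc n)
  ⟦⟧-+ (ℤ.+ m)   (ℤ.+ n)   = ×-homo-+ 1# m n

  ⟦⟧-neg : ∀ i → ⟦ ℤ.- i ⟧ ≈ - ⟦ i ⟧
  ⟦⟧-neg (ℤ.+ zero)    = ≈-sym -0#≈0#
  ⟦⟧-neg (ℤ.+ suc n)   = ≈-refl
  ⟦⟧-neg -[1+ n ]      = ≈-sym (-‿involutive _)

  ⟦_⟧ₛ : Sign → Carrier
  ⟦ Sign.+ ⟧ₛ = 1#
  ⟦ Sign.- ⟧ₛ = - 1#

  ⟦⟧ₛ-* : ∀ s t → ⟦ s Sign.* t ⟧ₛ ≈ ⟦ s ⟧ₛ * ⟦ t ⟧ₛ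
  ⟦⟧ₛ-* Sign.+ t      = ≈-sym (*-identityˡ _)
  ⟦⟧ₛ-* Sign.- Sign.+ = ≈-sym (*-identityʳ _)
  ⟦⟧ₛ-* Sign.- Sign.- = ≈-sym (≈-trans (-1*x≈-x _) (-‿involutive 1#))

  ⟦⟧-◃ : ∀ s n → ⟦ s ◃ n ⟧ ≈ ⟦ s ⟧ₛ * (n ×′ 1#)
  ⟦⟧-◃ s      zero    = ≈-sym (zeroʳ _)
  ⟦⟧-◃ Sign.+ (suc n) = ≈-sym (*-identityˡ _)
  ⟦⟧-◃ Sign.- (suc n) = ≈-sym (-1*x≈-x _)

  ⟦⟧-signAbs : ∀ i → ⟦ i ⟧ ≈ ⟦ sign i ⟧ₛ * (∣ i ∣ ×′ 1#)
  ⟦⟧-signAbs (ℤ.+ zero)  = ≈-sym (zeroʳ _)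
  ⟦⟧-signAbs (ℤ.+ suc n) = ≈-sym (*-identityˡ _)
  ⟦⟧-signAbs -[1+ n ]    = ≈-sym (-1*x≈-x _)

  ⟦⟧-* : ∀ i j → ⟦ i ℤ.* j ⟧ ≈ ⟦ i ⟧ * ⟦ j ⟧
  ⟦⟧-* i j = begin
    ⟦ (sign i Sign.* sign j) ◃ (∣ i ∣ ℕ.* ∣ j ∣) ⟧            ≈⟨ ⟦⟧-◃ (sign i Sign.* sign j) (∣ i ∣ ℕ.* ∣ j ∣) ⟩
    ⟦ sign i Sign.* sign j ⟧ₛ * ((∣ i ∣ ℕ.* ∣ j ∣) ×′ 1#)     ≈⟨ *-cong (⟦⟧ₛ-* (sign i) (sign j))
                                                                       (×1-homo-* ∣ i ∣ ∣ j ∣) ⟩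
    ⟦ sign i ⟧ₛ * ⟦ sign j ⟧ₛ * (∣ i ∣ ×′ 1# * (∣ j ∣ ×′ 1#))  ≈⟨ interchange _ _ _ _ ⟩
    ⟦ sign i ⟧ₛ * (∣ i ∣ ×′ 1#) * (⟦ sign j ⟧ₛ * (∣ j ∣ ×′ 1#)) ≈⟨ *-cong (⟦⟧-signAbs i) (⟦⟧-signAbs j) ⟨
    ⟦ i ⟧ * ⟦ j ⟧                                             ∎

  homomorphism : ACR._-Raw-AlmostCommutative⟶_ (CommutativeRing.rawRing ℤ.+-*-commutativeRing)
                                                (ACR.fromCommutativeRing R)
  homomorphism = record
    { ⟦_⟧ = ⟦_⟧ ; +-homo = ⟦⟧-+ ; *-homo = ⟦⟧-* ; -‿homo = ⟦⟧-neg
    ; 0-homo = ≈-refl ; 1-homo = ≈-refl }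

  _≟⟦⟧_ : ∀ i j → Maybe (⟦ i ⟧ ≈ ⟦ j ⟧)
  i ≟⟦⟧ j with i ℤ.≟ j
  ... | yes i≡j = just (≈-reflexive (cong ⟦_⟧ i≡j))
  ... | no  _   = nothing

  open import Algebra.Solver.Ring _ (ACR.fromCommutativeRing R) homomorphism _≟⟦⟧_ public
    using (solve; Polynomial; _:=_; _:+_; _:*_; _:-_; :-_)

  κ : ∀ {n} → ℕ → Polynomial n
  κ k = Polynomial.con (ℤ.+ k)

length-cartesianProductWith : ∀ {a b d} {A : Set a} {B : Set b} {D : Set d} (f : A → B → D) xs ys →
                              length (cartesianProductWith f xs ys) ≡ length xs ℕ.* length ys
length-cartesianProductWith f []       ys = refl
length-cartesianProductWith f (x ∷ xs) ys = begin
  length (map (f x) ys ++ cartesianProductWith f xs ys)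
    ≡⟨ List.length-++ (map (f x) ys) ⟩
  length (map (f x) ys) ℕ.+ length (cartesianProductWith f xs ys)
    ≡⟨ cong₂ ℕ._+_ (List.length-map (f x) ys) (length-cartesianProductWith f xs ys) ⟩
  length ys ℕ.+ length xs ℕ.* length ys
    ∎
  where open ≡-Reasoning

module Enumeration {a} {A : Set a} {m} (e : Fin (suc m) ↔ A) where
  open Inverse e using (to; from; strictlyInverseˡ; strictlyInverseʳ)

  to-injective : Injective _≡_ _≡_ to
  to-injective = Injection.injective (↔⇒↣ e)

  from-injective : Injective _≡_ _≡_ from
  from-injective = Injection.injective (↔⇒↣ (↔-sym e))

  elements : List A
  elements = tabulate to

  length-elements : length elements ≡ suc m
  length-elements = List.length-tabulate to

  elements-unique : Unique elements
  elements-unique = Unique.tabulate⁺ to-injective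

  ∈-elements : ∀ x → x ∈ elements
  ∈-elements x = subst (_∈ elements) (strictlyInverseˡ x) (Membership.∈-tabulate⁺ {f = to} (from x))

  elementsExcept : A → List A
  elementsExcept y = tabulate (to ∘ Fin.punchIn (from y))

  length-elementsExcept : ∀ y → length (elementsExcept y) ≡ m
  length-elementsExcept y = List.length-tabulate (to ∘ Fin.punchIn (from y))

  elementsExcept-unique : ∀ y → Unique (elementsExcept y)
  elementsExcept-unique y = Unique.tabulate⁺ (Fin.punchIn-injective (from y) _ _ ∘ to-injective)

  ∈-elementsExcept⇔ : ∀ {x y} → x ∈ elementsExcept y ⇔ x ≢ y
  ∈-elementsExcept⇔ {x} {y} = mk⇔ ∈⇒≢ ≢⇒∈
    where
    ∈⇒≢ : x ∈ elementsExcept y → x ≢ y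
    ∈⇒≢ x∈ refl with i , x≡ ← Membership.∈-tabulate⁻ x∈ =
      Fin.punchInᵢ≢i (from x) i (trans (sym (strictlyInverseʳ _)) (cong from (sym x≡)))
    ≢⇒∈ : x ≢ y → x ∈ elementsExcept y
    ≢⇒∈ x≢y = subst (_∈ elementsExcept y) (trans (cong to (Fin.punchIn-punchOut y≢x)) (strictlyInverseˡ x))
                    (Membership.∈-tabulate⁺ {f = to ∘ Fin.punchIn (from y)} (Fin.punchOut y≢x))
      where
      y≢x : from y ≢ from x
      y≢x = x≢y ∘ sym ∘ from-injective

injective⇒¬omits : ∀ {a} {A : Set a} {n} → Fin n ↔ A → {f : A → A} → Injective _≡_ _≡_ f →
                   ∀ y → ¬ (∀ x → f x ≢ y)
injective⇒¬omits {n = zero}  e         inj y omits = Fin.¬Fin0 (Inverse.from e y)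
injective⇒¬omits {n = suc m} e {f} inj y omits = ℕ.<-irrefl refl (Fin.injective⇒≤ h-injective)
  where
  open Inverse e using (to; from)
  open Enumeration e using (to-injective; from-injective)
  y≢f∘to : ∀ i → from y ≢ from (f (to i))
  y≢f∘to i eq = omits (to i) (sym (from-injective eq))
  h : Fin (suc m) → Fin m
  h i = Fin.punchOut (y≢f∘to i)
  h-injective : Injective _≡_ _≡_ h
  h-injective eq = to-injective (inj (from-injective (Fin.punchOut-injective (y≢f∘to _) (y≢f∘to _) eq)))

module LinearSudoku {c} (𝔽 : FiniteField c) where
  open FF 𝔽

  commutativeRing : CommutativeRing c c
  commutativeRing = record { isCommutativeRing = isCommutativeRing }

  open CommutativeRing commutativeRing using (*-comm; *-identityˡ; *-identityʳ; zeroʳ; +-group)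
  open import Algebra.Properties.Group +-group using (x∙y⁻¹≈ε⇒x≈y; x≈y⇒x∙y⁻¹≈ε)
  open IntegerCoefficients commutativeRing using (solve; κ; _:=_; _:+_; _:*_; _:-_; :-_)
  open ≡-Reasoning

  infixl 6 _-_
  _-_ : Carrier → Carrier → Carrier
  x - y = x + - y

  _≟_ : DecidableEquality Carrier
  _≟_ = Fin.inj⇒≟ (↔⇒↣ (↔-sym enum))

  x*y≡0⇒y≡0 : ∀ {x y} → x ≢ 0# → x * y ≡ 0# → y ≡ 0#
  x*y≡0⇒y≡0 {x} {y} x≢0 xy≡0 with inverse x x≢0
  ... | x⁻¹ , x*x⁻¹≡1 = begin
    y                  ≡⟨ *-identityˡ y ⟨
    1# * y             ≡⟨ cong (_* y) x*x⁻¹≡1 ⟨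
    x * x⁻¹ * y        ≡⟨ solve 3 (λ a b d → a :* b :* d := b :* (a :* d)) refl x x⁻¹ y ⟩
    x⁻¹ * (x * y)      ≡⟨ cong (x⁻¹ *_) xy≡0 ⟩
    x⁻¹ * 0#           ≡⟨ zeroʳ x⁻¹ ⟩
    0#                 ∎

  x*x≡0⇒x≡0 : ∀ {x} → x * x ≡ 0# → x ≡ 0#
  x*x≡0⇒x≡0 {x} xx≡0 with x ≟ 0#
  ... | yes x≡0 = x≡0
  ... | no  x≢0 = x*y≡0⇒y≡0 x≢0 xx≡0

  -≡-⇒≡⇔≡ : ∀ {a b d e} → a - b ≡ d - e → (a ≡ b ⇔ d ≡ e)
  -≡-⇒≡⇔≡ {a} {b} {d} {e} eq = mk⇔
    (λ a≡b → x∙y⁻¹≈ε⇒x≈y d e (trans (sym eq) (x≈y⇒x∙y⁻¹≈ε a≡b)))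
    (λ d≡e → x∙y⁻¹≈ε⇒x≈y a b (trans eq (x≈y⇒x∙y⁻¹≈ε d≡e)))

  IsSquare-quotient : ∀ {x y z} → y ≢ 0# → x * x ≡ y * y * z → IsSquare z
  IsSquare-quotient {x} {y} {z} y≢0 xx≡yyz with inverse y y≢0
  ... | y⁻¹ , y*y⁻¹≡1 = x * y⁻¹ , (begin
    x * y⁻¹ * (x * y⁻¹)       ≡⟨ solve 2 (λ a b → a :* b :* (a :* b) := a :* a :* (b :* b)) refl x y⁻¹ ⟩
    x * x * (y⁻¹ * y⁻¹)       ≡⟨ cong (_* (y⁻¹ * y⁻¹)) xx≡yyz ⟩
    y * y * z * (y⁻¹ * y⁻¹)   ≡⟨ solve 3 (λ a b d → a :* a :* d :* (b :* b) := a :* b :* (a :* b) :* d)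
                                         refl y y⁻¹ z ⟩
    y * y⁻¹ * (y * y⁻¹) * z   ≡⟨ cong (λ t → t * t * z) y*y⁻¹≡1 ⟩
    1# * 1# * z               ≡⟨ solve 1 (λ d → κ 1 :* κ 1 :* d := d) refl z ⟩
    z                         ∎)

  nonsquare⇒2≢0 : ∀ {a} → ¬ IsSquare a → 2# ≢ 0#
  nonsquare⇒2≢0 {a} ¬□a 2≡0 = injective⇒¬omits enum square-injective a (λ x xx≡a → ¬□a (x , xx≡a))
    where
    -- In characteristic 2, (x - y)² = x² - y², so squaring is injective.
    square-injective : Injective _≡_ _≡_ (λ x → x * x)
    square-injective {x} {y} xx≡yy = x∙y⁻¹≈ε⇒x≈y x y (x*x≡0⇒x≡0 (begin
      (x - y) * (x - y)                      ≡⟨ expand x y ⟩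
      x * x - y * y + 2# * (y * y - x * y)   ≡⟨ cong₂ (λ s t → s - y * y + t * (y * y - x * y)) xx≡yy 2≡0 ⟩
      y * y - y * y + 0# * (y * y - x * y)   ≡⟨ vanish x y ⟩
      0#                                     ∎))
      where
      expand : ∀ x y → (x - y) * (x - y) ≡ x * x - y * y + 2# * (y * y - x * y)
      expand = solve 2 (λ a b → (a :- b) :* (a :- b) := a :* a :- b :* b :+ κ 2 :* (b :* b :- a :* b)) refl
      vanish : ∀ x y → y * y - y * y + 0# * (y * y - x * y) ≡ 0#
      vanish = solve 2 (λ a b → b :* b :- b :* b :+ κ 0 :* (b :* b :- a :* b) := κ 0) refl

  V2 : Set c
  V2 = Carrier × Carrier

  infixl 6 _+₂_ _-₂_ _-ₘ_
  infixr 7 _*ₗ_ _·_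

  _+₂_ _-₂_ : V2 → V2 → V2
  (a₁ , a₂) +₂ (b₁ , b₂) = (a₁ + b₁ , a₂ + b₂)
  (a₁ , a₂) -₂ (b₁ , b₂) = (a₁ - b₁ , a₂ - b₂)

  _*ₗ_ : Carrier → V2 → V2
  k *ₗ (a₁ , a₂) = (k * a₁ , k * a₂)

  -- Written a₁ * c₁₁ rather than c₁₁ * a₁ so that C · (a₁ , a₂) is literally the lower half of _∈[I/_].
  _·_ : Mat → V2 → V2
  (c₁₁ , c₁₂ , c₂₁ , c₂₂) · (a₁ , a₂) = (a₁ * c₁₁ + a₂ * c₁₂ , a₁ * c₂₁ + a₂ * c₂₂)

  _-ₘ_ : Mat → Mat → Mat
  (c₁₁ , c₁₂ , c₂₁ , c₂₂) -ₘ (d₁₁ , d₁₂ , d₂₁ , d₂₂) = (c₁₁ - d₁₁ , c₁₂ - d₁₂ , c₂₁ - d₂₁ , c₂₂ - d₂₂)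

  det : Mat → Carrier
  det (c₁₁ , c₁₂ , c₂₁ , c₂₂) = c₁₁ * c₂₂ - c₁₂ * c₂₁

  adj : Mat → Mat
  adj (c₁₁ , c₁₂ , c₂₁ , c₂₂) = (c₂₂ , - c₁₂ , - c₂₁ , c₁₁)

  ≡⇔≡×≡ : ∀ {a₁ a₂ b₁ b₂ : Carrier} → ((a₁ , a₂) ≡ (b₁ , b₂)) ⇔ (a₁ ≡ b₁ × a₂ ≡ b₂)
  ≡⇔≡×≡ = mk⇔ ×-≡,≡←≡ ×-≡,≡→≡

  -₂≡-₂⇒≡⇔≡ : ∀ {a b d e : V2} → a -₂ b ≡ d -₂ e → (a ≡ b ⇔ d ≡ e)
  -₂≡-₂⇒≡⇔≡ eq with eq₁ , eq₂ ← ×-≡,≡←≡ eq =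
    ⇔-sym ≡⇔≡×≡ ⇔-∘ ((-≡-⇒≡⇔≡ eq₁ ×-⇔ -≡-⇒≡⇔≡ eq₂) ⇔-∘ ≡⇔≡×≡)

  adj-·-det : ∀ C u → adj C · (C · u) ≡ det C *ₗ u
  adj-·-det (a , b , d , e) (u₁ , u₂) = cong₂ _,_
    (solve 6 (λ a b d e u₁ u₂ → (u₁ :* a :+ u₂ :* b) :* e :+ (u₁ :* d :+ u₂ :* e) :* (:- b)
                               := (a :* e :- b :* d) :* u₁) refl a b d e u₁ u₂)
    (solve 6 (λ a b d e u₁ u₂ → (u₁ :* a :+ u₂ :* b) :* (:- d) :+ (u₁ :* d :+ u₂ :* e) :* a
                               := (a :* e :- b :* d) :* u₂) refl a b d e u₁ u₂)

  ·-adj-det : ∀ C u → C · (adj C · u) ≡ det C *ₗ u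
  ·-adj-det (a , b , d , e) (u₁ , u₂) = cong₂ _,_
    (solve 6 (λ a b d e u₁ u₂ → (u₁ :* e :+ u₂ :* (:- b)) :* a :+ (u₁ :* (:- d) :+ u₂ :* a) :* b
                               := (a :* e :- b :* d) :* u₁) refl a b d e u₁ u₂)
    (solve 6 (λ a b d e u₁ u₂ → (u₁ :* e :+ u₂ :* (:- b)) :* d :+ (u₁ :* (:- d) :+ u₂ :* a) :* e
                               := (a :* e :- b :* d) :* u₂) refl a b d e u₁ u₂)

  ·-*ₗ : ∀ C k u → C · (k *ₗ u) ≡ k *ₗ (C · u)
  ·-*ₗ (a , b , d , e) k (u₁ , u₂) = cong₂ _,_ (linear a b) (linear d e)
    where
    linear : ∀ p q → k * u₁ * p + k * u₂ * q ≡ k * (u₁ * p + u₂ * q)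
    linear = solve 5 (λ k u₁ u₂ p q → k :* u₁ :* p :+ k :* u₂ :* q := k :* (u₁ :* p :+ u₂ :* q)) refl k u₁ u₂

  *ₗ-inverse : ∀ {k δ} → k * δ ≡ 1# → ∀ u → δ *ₗ (k *ₗ u) ≡ u
  *ₗ-inverse {k} {δ} kδ≡1 (u₁ , u₂) = cong₂ _,_ (cancel u₁) (cancel u₂)
    where
    cancel : ∀ a → δ * (k * a) ≡ a
    cancel a = begin
      δ * (k * a)   ≡⟨ solve 3 (λ δ k a → δ :* (k :* a) := k :* δ :* a) refl δ k a ⟩
      k * δ * a     ≡⟨ cong (_* a) kδ≡1 ⟩
      1# * a        ≡⟨ *-identityˡ a ⟩
      a             ∎

  ∃!-≡ : {A : Set c} (a : A) → ∃! (_≡ a)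
  ∃!-≡ a = a , refl , λ _ b≡a → b≡a

  ∃!-cong : {A : Set c} {P Q : A → Set c} → (∀ a → P a ⇔ Q a) → ∃! P → ∃! Q
  ∃!-cong P⇔Q (a , pa , unique) =
    a , Equivalence.to (P⇔Q a) pa , λ b qb → unique b (Equivalence.from (P⇔Q b) qb)

  ∃!-↔ : {A B : Set c} {P : B → Set c} (e : A ↔ B) → ∃! P → ∃! (P ∘ Inverse.to e)
  ∃!-↔ {P = P} e (b , pb , unique) =
    from b , subst P (sym (strictlyInverseˡ b)) pb ,
    λ a pa → trans (sym (strictlyInverseʳ a)) (cong from (unique (to a) pa))
    where open Inverse e

  ∃!-× : {A B : Set c} {P : A → Set c} {Q : A → B → Set c} →
         ∃! P → (∀ a → ∃! (Q a)) → ∃! (λ (a , b) → P a × Q a b)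
  ∃!-× {Q = Q} (a , pa , uniqueᴬ) ∃!Q with b , qab , uniqueᴮ ← ∃!Q a =
    (a , b) , (pa , qab) , λ (a′ , b′) (pa′ , qa′b′) →
      let a′≡a = uniqueᴬ a′ pa′ in cong₂ _,_ a′≡a (uniqueᴮ b′ (subst (λ x → Q x b′) a′≡a qa′b′))

  ·-solvable : ∀ C → det C ≢ 0# → ∀ r → ∃! (λ u → C · u ≡ r)
  ·-solvable C det≢0 r with δ , detδ≡1 ← inverse (det C) det≢0 =
    δ *ₗ (adj C · r) , solution , unique
    where
    solution : C · (δ *ₗ (adj C · r)) ≡ r
    solution = begin
      C · (δ *ₗ (adj C · r))   ≡⟨ ·-*ₗ C δ (adj C · r) ⟩
      δ *ₗ (C · (adj C · r))   ≡⟨ cong (δ *ₗ_) (·-adj-det C r) ⟩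
      δ *ₗ (det C *ₗ r)        ≡⟨ *ₗ-inverse detδ≡1 r ⟩
      r                        ∎
    unique : ∀ u → C · u ≡ r → u ≡ δ *ₗ (adj C · r)
    unique u Cu≡r = begin
      u                        ≡⟨ *ₗ-inverse detδ≡1 u ⟨
      δ *ₗ (det C *ₗ u)        ≡⟨ cong (δ *ₗ_) (adj-·-det C u) ⟨
      δ *ₗ (adj C · (C · u))   ≡⟨ cong (λ v → δ *ₗ (adj C · v)) Cu≡r ⟩
      δ *ₗ (adj C · r)         ∎

  *-solvable : ∀ {w} → w ≢ 0# → ∀ r → ∃! (λ u → u * w ≡ r)
  *-solvable {w} w≢0 r with w⁻¹ , ww⁻¹≡1 ← inverse w w≢0 =
    r * w⁻¹ , undo w⁻¹ w ww⁻¹≡1 r ,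
    λ u uw≡r → trans (sym (undo w w⁻¹ (trans (*-comm w⁻¹ w) ww⁻¹≡1) u)) (cong (_* w⁻¹) uw≡r)
    where
    undo : ∀ p q → q * p ≡ 1# → ∀ a → a * p * q ≡ a
    undo p q qp≡1 a = begin
      a * p * q     ≡⟨ solve 3 (λ a p q → a :* p :* q := a :* (q :* p)) refl a p q ⟩
      a * (q * p)   ≡⟨ cong (a *_) qp≡1 ⟩
      a * 1#        ≡⟨ *-identityʳ a ⟩
      a             ∎

  offset : Mat → V4 → V2
  offset C (s₁ , s₂ , s₃ , s₄) = C · (s₁ , s₂) -₂ (s₃ , s₄)

  -- The coset s + [ I ; C ] is the graph of this affine map.
  affine : Mat → V4 → V2 → V2
  affine C s u = C · u -₂ offset C s

  I : Mat
  I = (1# , 0# , 0# , 1#)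

  I·-identity : ∀ u → I · u ≡ u
  I·-identity (a₁ , a₂) = cong₂ _,_
    (solve 2 (λ a₁ a₂ → a₁ :* κ 1 :+ a₂ :* κ 0 := a₁) refl a₁ a₂)
    (solve 2 (λ a₁ a₂ → a₁ :* κ 0 :+ a₂ :* κ 1 := a₂) refl a₁ a₂)

  ∈[I/]⇒ : ∀ {C a₁ a₂ a₃ a₄} → (a₁ , a₂ , a₃ , a₄) ∈[I/ C ] → (a₃ , a₄) ≡ C · (a₁ , a₂)
  ∈[I/]⇒ {C} (a , b , refl) = cong (C ·_) (sym (I·-identity (a , b)))

  ∈[I/]⇐ : ∀ {C a₁ a₂ a₃ a₄} → (a₃ , a₄) ≡ C · (a₁ , a₂) → (a₁ , a₂ , a₃ , a₄) ∈[I/ C ]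
  ∈[I/]⇐ {C} {a₁} {a₂} refl =
    a₁ , a₂ , cong (λ (b₁ , b₂) → b₁ , b₂ , C · (a₁ , a₂)) (sym (I·-identity (a₁ , a₂)))

  SameSymbol⇔graph : ∀ C x₁ x₂ x₃ x₄ s →
                     SameSymbol C (x₁ , x₂ , x₃ , x₄) s ⇔ ((x₃ , x₄) ≡ affine C s (x₁ , x₂))
  SameSymbol⇔graph (c₁₁ , c₁₂ , c₂₁ , c₂₂) x₁ x₂ x₃ x₄ (s₁ , s₂ , s₃ , s₄) =
    -₂≡-₂⇒≡⇔≡ (cong₂ _,_ (shift x₃ s₃ c₁₁ c₁₂) (shift x₄ s₄ c₂₁ c₂₂)) ⇔-∘ mk⇔ ∈[I/]⇒ ∈[I/]⇐
    where
    shift : ∀ x s d e → (x - s) - ((x₁ - s₁) * d + (x₂ - s₂) * e)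
                        ≡ x - ((x₁ * d + x₂ * e) - ((s₁ * d + s₂ * e) - s))
    shift = solve 8 (λ x₁ x₂ s₁ s₂ x s d e → (x :- s) :- ((x₁ :- s₁) :* d :+ (x₂ :- s₂) :* e)
                                          := x :- ((x₁ :* d :+ x₂ :* e) :- ((s₁ :* d :+ s₂ :* e) :- s)))
                    refl x₁ x₂ s₁ s₂

  row-∃! : ∀ C x₁ x₂ s → ∃! (λ (x₃ , x₄) → SameSymbol C (x₁ , x₂ , x₃ , x₄) s)
  row-∃! C x₁ x₂ s =
    ∃!-cong (λ (x₃ , x₄) → ⇔-sym (SameSymbol⇔graph C x₁ x₂ x₃ x₄ s)) (∃!-≡ (affine C s (x₁ , x₂)))

  column-∃! : ∀ C → det C ≢ 0# → ∀ x₃ x₄ s → ∃! (λ (x₁ , x₂) → SameSymbol C (x₁ , x₂ , x₃ , x₄) s)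
  column-∃! C det≢0 x₃ x₄ s = ∃!-cong solution⇔ (·-solvable C det≢0 ((x₃ , x₄) +₂ offset C s))
    where
    move : ∀ l o x → (l - o) - x ≡ l - (x + o)
    move = solve 3 (λ l o x → (l :- o) :- x := l :- (x :+ o)) refl
    solution⇔ : ∀ u → (C · u ≡ (x₃ , x₄) +₂ offset C s) ⇔ SameSymbol C (proj₁ u , proj₂ u , x₃ , x₄) s
    solution⇔ (x₁ , x₂) = ⇔-sym (SameSymbol⇔graph C x₁ x₂ x₃ x₄ s)
      ⇔-∘ (mk⇔ sym sym ⇔-∘ ⇔-sym (-₂≡-₂⇒≡⇔≡ (cong₂ _,_ (move _ _ _) (move _ _ _))))

  subsquare-∃! : ∀ {c₁₁ c₁₂ c₂₁ c₂₂} → c₁₂ ≢ 0# → ∀ x₁ x₃ s →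
                 ∃! (λ (x₂ , x₄) → SameSymbol (c₁₁ , c₁₂ , c₂₁ , c₂₂) (x₁ , x₂ , x₃ , x₄) s)
  subsquare-∃! {c₁₁} {c₁₂} {c₂₁} {c₂₂} c₁₂≢0 x₁ x₃ s =
    ∃!-cong solution⇔ (∃!-× (*-solvable c₁₂≢0 r) (λ x₂ → ∃!-≡ (proj₂ (affine C s (x₁ , x₂)))))
    where
    C : Mat
    C = (c₁₁ , c₁₂ , c₂₁ , c₂₂)
    o : Carrier
    o = proj₁ (offset C s)
    r : Carrier
    r = (x₃ + o) - x₁ * c₁₁
    move : ∀ x₂ → (x₁ * c₁₁ + x₂ * c₁₂ - o) - x₃ ≡ x₂ * c₁₂ - r
    move x₂ = solve 6 (λ x₁ x₂ x₃ c₁₁ c₁₂ o → (x₁ :* c₁₁ :+ x₂ :* c₁₂ :- o) :- x₃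
                                            := x₂ :* c₁₂ :- ((x₃ :+ o) :- x₁ :* c₁₁))
                      refl x₁ x₂ x₃ c₁₁ c₁₂ o
    solution⇔ : ∀ u → (proj₁ u * c₁₂ ≡ r × proj₂ u ≡ proj₂ (affine C s (x₁ , proj₁ u)))
                      ⇔ SameSymbol C (x₁ , proj₁ u , x₃ , proj₂ u) s
    solution⇔ (x₂ , x₄) = ⇔-sym (SameSymbol⇔graph C x₁ x₂ x₃ x₄ s) ⇔-∘ (⇔-sym ≡⇔≡×≡
      ⇔-∘ ((mk⇔ sym sym ⇔-∘ ⇔-sym (-≡-⇒≡⇔≡ (move x₂))) ×-⇔ ⇔-id _))

  sudoku-criterion : ∀ {c₁₁ c₁₂ c₂₁ c₂₂} → det (c₁₁ , c₁₂ , c₂₁ , c₂₂) ≢ 0# → c₁₂ ≢ 0# →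
                     GeneratesSudoku (c₁₁ , c₁₂ , c₂₁ , c₂₂)
  sudoku-criterion det≢0 c₁₂≢0 = row-∃! _ , column-∃! _ det≢0 , subsquare-∃! c₁₂≢0

  split : V4 ↔ (V2 × V2)
  split = mk↔ₛ′ (λ (x₁ , x₂ , x₃ , x₄) → (x₁ , x₂) , (x₃ , x₄))
                (λ ((x₁ , x₂) , (x₃ , x₄)) → x₁ , x₂ , x₃ , x₄)
                (λ _ → refl) (λ _ → refl)

  orthogonality-criterion : ∀ C D → det (C -ₘ D) ≢ 0# → Orthogonal C D
  orthogonality-criterion C@(c₁₁ , c₁₂ , c₂₁ , c₂₂) D@(d₁₁ , d₁₂ , d₂₁ , d₂₂) det≢0 s t =
    ∃!-↔ {P = λ ((x₁ , x₂) , (x₃ , x₄)) → SameSymbol C (x₁ , x₂ , x₃ , x₄) s × SameSymbol D (x₁ , x₂ , x₃ , x₄) t}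
      split
      (∃!-cong on-both⇔
        (∃!-× (∃!-cong meet⇔ (·-solvable (C -ₘ D) det≢0 (offset C s -₂ offset D t)))
              (λ u → ∃!-≡ (affine C s u))))
    where
    difference : ∀ u₁ u₂ c₁ c₂ d₁ d₂ o o′ → (u₁ * c₁ + u₂ * c₂ - o) - (u₁ * d₁ + u₂ * d₂ - o′)
                                          ≡ (u₁ * (c₁ - d₁) + u₂ * (c₂ - d₂)) - (o - o′)
    difference = solve 8 (λ u₁ u₂ c₁ c₂ d₁ d₂ o o′ → (u₁ :* c₁ :+ u₂ :* c₂ :- o) :- (u₁ :* d₁ :+ u₂ :* d₂ :- o′)
                                                  := (u₁ :* (c₁ :- d₁) :+ u₂ :* (c₂ :- d₂)) :- (o :- o′)) refl
    meet⇔ : ∀ u → ((C -ₘ D) · u ≡ offset C s -₂ offset D t) ⇔ (affine C s u ≡ affine D t u)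
    meet⇔ (u₁ , u₂) = ⇔-sym (-₂≡-₂⇒≡⇔≡ (cong₂ _,_ (difference u₁ u₂ c₁₁ c₁₂ d₁₁ d₁₂ _ _)
                                                   (difference u₁ u₂ c₂₁ c₂₂ d₂₁ d₂₂ _ _)))
    on-both⇔ : ∀ (((x₁ , x₂) , (x₃ , x₄)) : V2 × V2) →
               (affine C s (x₁ , x₂) ≡ affine D t (x₁ , x₂) × (x₃ , x₄) ≡ affine C s (x₁ , x₂))
               ⇔ (SameSymbol C (x₁ , x₂ , x₃ , x₄) s × SameSymbol D (x₁ , x₂ , x₃ , x₄) t)
    on-both⇔ ((x₁ , x₂) , (x₃ , x₄)) =
      (⇔-sym (SameSymbol⇔graph C x₁ x₂ x₃ x₄ s) ×-⇔ ⇔-sym (SameSymbol⇔graph D x₁ x₂ x₃ x₄ t))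
      ⇔-∘ mk⇔ (λ (meet , onC) → onC , trans onC meet) (λ (onC , onD) → trans (sym onC) onD , onC)

  discriminant-nonsquare : ∀ {α λ'} → ¬ IsSquare (α + 1#) → λ' * λ' ≡ 2# * 2# * α →
                           ¬ IsSquare (λ' * λ' + 2# * 2#)
  discriminant-nonsquare {α} {λ'} ¬□[α+1] λ'λ'≡4α (t , tt≡disc) =
    ¬□[α+1] (IsSquare-quotient (nonsquare⇒2≢0 ¬□[α+1]) (begin
      t * t                    ≡⟨ tt≡disc ⟩
      λ' * λ' + 2# * 2#        ≡⟨ cong (_+ 2# * 2#) λ'λ'≡4α ⟩
      2# * 2# * α + 2# * 2#    ≡⟨ solve 1 (λ a → κ 2 :* κ 2 :* a :+ κ 2 :* κ 2 := κ 2 :* κ 2 :* (a :+ κ 1)) refl α ⟩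
      2# * 2# * (α + 1#)       ∎))

  module Family (λ' : Carrier) where

    member : Carrier → Carrier → Mat
    member v w = (v , w , w , λ' * w + v)

    norm : Carrier → Carrier → Carrier
    norm v w = det (member v w)

    discriminant : Carrier
    discriminant = λ' * λ' + 2# * 2#

    norm-completing-square : ∀ v w →
      (2# * v + λ' * w) * (2# * v + λ' * w) ≡ 2# * 2# * norm v w + w * w * discriminant
    norm-completing-square = solve 3 (λ l v w →
        (κ 2 :* v :+ l :* w) :* (κ 2 :* v :+ l :* w)
      := κ 2 :* κ 2 :* (v :* (l :* w :+ v) :- w :* w)
         :+ w :* w :* (l :* l :+ κ 2 :* κ 2)) refl λ'

    norm-v-0 : ∀ v → norm v 0# ≡ v * v
    norm-v-0 = solve 2 (λ l v → v :* (l :* κ 0 :+ v) :- κ 0 :* κ 0 := v :* v) refl λ'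

    norm-anisotropic : ¬ IsSquare discriminant → ∀ {v w} → norm v w ≡ 0# → v ≡ 0# × w ≡ 0#
    norm-anisotropic ¬□ {v} {w} norm≡0 with w ≟ 0#
    ... | yes refl = x*x≡0⇒x≡0 (trans (sym (norm-v-0 v)) norm≡0) , refl
    ... | no  w≢0  = ⊥-elim (¬□ (IsSquare-quotient w≢0 (begin
      (2# * v + λ' * w) * (2# * v + λ' * w)      ≡⟨ norm-completing-square v w ⟩
      2# * 2# * norm v w + w * w * discriminant   ≡⟨ cong (λ n → 2# * 2# * n + w * w * discriminant) norm≡0 ⟩
      2# * 2# * 0# + w * w * discriminant         ≡⟨ solve 2 (λ a b → κ 2 :* κ 2 :* κ 0 :+ a :* a :* b := a :* a :* b)
                                                            refl w discriminant ⟩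
      w * w * discriminant                        ∎)))

    member-difference : ∀ v₁ w₁ v₂ w₂ → member v₁ w₁ -ₘ member v₂ w₂ ≡ member (v₁ - v₂) (w₁ - w₂)
    member-difference v₁ w₁ v₂ w₂ = cong (λ x → v₁ - v₂ , w₁ - w₂ , w₁ - w₂ , x)
      (solve 5 (λ l v₁ w₁ v₂ w₂ → (l :* w₁ :+ v₁) :- (l :* w₂ :+ v₂) := l :* (w₁ :- w₂) :+ (v₁ :- v₂))
               refl λ' v₁ w₁ v₂ w₂)

    𝓕-sudoku : ¬ IsSquare discriminant → ∀ C → C ∈𝓕[ λ' ] → GeneratesSudoku C
    𝓕-sudoku ¬□ _ (v , w , w≢0 , refl) = sudoku-criterion (w≢0 ∘ proj₂ ∘ norm-anisotropic ¬□) w≢0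

    𝓕-orthogonal : ¬ IsSquare discriminant → ∀ C D → C ∈𝓕[ λ' ] → D ∈𝓕[ λ' ] → C ≢ D → Orthogonal C D
    𝓕-orthogonal ¬□ _ _ (v₁ , w₁ , _ , refl) (v₂ , w₂ , _ , refl) C≢D = orthogonality-criterion _ _ det≢0
      where
      det≢0 : det (member v₁ w₁ -ₘ member v₂ w₂) ≢ 0#
      det≢0 det≡0
        with v≡0 , w≡0 ← norm-anisotropic ¬□ (trans (cong det (sym (member-difference v₁ w₁ v₂ w₂))) det≡0) =
        C≢D (cong₂ member (x∙y⁻¹≈ε⇒x≈y v₁ v₂ v≡0) (x∙y⁻¹≈ε⇒x≈y w₁ w₂ w≡0))

    𝓕-cardinality : ∀ {n} → Fin n ↔ Carrier → HasCard (_∈𝓕[ λ' ]) (n ℕ.* (n ℕ.∸ 1))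
    𝓕-cardinality {zero}  e = ⊥-elim (Fin.¬Fin0 (Inverse.from e 0#))
    𝓕-cardinality {suc m} e =
      cartesianProductWith member elements (elementsExcept 0#) ,
      trans (length-cartesianProductWith member elements (elementsExcept 0#))
            (cong₂ ℕ._*_ length-elements (length-elementsExcept 0#)) ,
      Unique.cartesianProductWith⁺ member member-injective elements-unique (elementsExcept-unique 0#) ,
      λ C → mk⇔ (listed⇒𝓕 C) 𝓕⇒listed
      where
      open Enumeration e
      member-injective : ∀ {v₁ v₂ w₁ w₂} → member v₁ w₁ ≡ member v₂ w₂ → v₁ ≡ v₂ × w₁ ≡ w₂
      member-injective eq = cong proj₁ eq , cong (proj₁ ∘ proj₂) eq
      listed⇒𝓕 : ∀ C → C ∈ cartesianProductWith member elements (elementsExcept 0#) → C ∈𝓕[ λ' ]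
      listed⇒𝓕 C C∈
        with v , w , _ , w∈ , C≡ ← Membership.∈-cartesianProductWith⁻ member elements (elementsExcept 0#) C∈ =
        v , w , Equivalence.to ∈-elementsExcept⇔ w∈ , C≡
      𝓕⇒listed : ∀ {C} → C ∈𝓕[ λ' ] → C ∈ cartesianProductWith member elements (elementsExcept 0#)
      𝓕⇒listed (v , w , w≢0 , refl) =
        Membership.∈-cartesianProductWith⁺ member (∈-elements v) (Equivalence.from ∈-elementsExcept⇔ w≢0)

theorem3p2 : ∀ {c : Level} (𝔽 : FiniteField c) → let open FF 𝔽 in
    ¬ (2 ∣ order) →
    (α λ' : Carrier) → IsSquare α → ¬ IsSquare (α + 1#) → λ' * λ' ≡ (2# * 2#) * α →
    HasCard (λ C → C ∈𝓕[ λ' ]) (order ℕ.* (order ℕ.∸ 1))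
    × (∀ C → C ∈𝓕[ λ' ] → GeneratesSudoku C)
    × (∀ C D → C ∈𝓕[ λ' ] → D ∈𝓕[ λ' ] → C ≢ D → Orthogonal C D)
theorem3p2 𝔽 _ α λ' _ ¬□[α+1] λ'λ'≡4α = 𝓕-cardinality enum , 𝓕-sudoku ¬□disc , 𝓕-orthogonal ¬□disc
  where
  open FF 𝔽 using (IsSquare; enum)
  open LinearSudoku 𝔽 using (discriminant-nonsquare; module Family)
  open Family λ' using (discriminant; 𝓕-cardinality; 𝓕-sudoku; 𝓕-orthogonal)
  ¬□disc : ¬ IsSquare discriminant
  ¬□disc = discriminant-nonsquare ¬□[α+1] λ'λ'≡4α
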